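{- If $s\ge 3$ is an integer, then $\mathrm{mob}(C_4\,\square\, P_s)=3$.
   Context: $C_4$ is the 4-cycle, $P_s$ the path on $s$ vertices, $\square$ the Cartesian product. A set $S\subseteq V(G)$ is a general position set if no three vertices of $S$ lie on a common shortest path. Robots are placed one per vertex of a general position set $S$; a move $u\to v$ along an edge $uv$ with $u\in S$ is legal if $v\notin S$ and $(S\setminus\{u\})\cup\{v\}$ is a general position set. $S$ is a mobile general position set if some sequence of legal moves starting from $S$ visits every vertex at least once; $\mathrm{mob}(G)$ is the maximum size of a mobile general position set. -}

module Defs where

open import Level using (0ℓ)
open import Data.Nat using (ℕ; zero; suc; _≤_; _%_; _+_)
open import Data.Fin using (Fin; toℕ)
open import Data.Product using (Σ; _×_; _,_; ∃)
open import Data.Sum using (_⊎_)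
open import Data.List using (List; []; _∷_; length)
open import Data.List.Membership.Propositional using (_∈_; _∉_)
open import Data.List.Relation.Unary.Any using (Any)
open import Data.List.Relation.Unary.Linked using (Linked)
open import Data.List.Relation.Unary.Unique.Propositional using (Unique)
open import Relation.Binary.PropositionalEquality using (_≡_; _≢_)
open import Relation.Nullary using (¬_)
open import Function.Bundles using (_⇔_)

record Graph : Set₁ where
  field
    V   : Set
    Adj : V → V → Set
open Graph public

Path : ℕ → Graph
Path s = record { V = Fin s
                ; Adj = λ i j → (toℕ j ≡ suc (toℕ i)) ⊎ (toℕ i ≡ suc (toℕ j)) }

C4 : Graph
C4 = record { V = Fin 4
            ; Adj = λ a b → (toℕ b ≡ suc (toℕ a) % 4) ⊎ (toℕ a ≡ suc (toℕ b) % 4) }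

_□_ : Graph → Graph → Graph
G □ H = record { V = V G × V H
               ; Adj = λ { (g , h) (g' , h') →
                   (h ≡ h' × Adj G g g') ⊎ (g ≡ g' × Adj H h h') } }

module _ (G : Graph) where

  data Walk : V G → V G → ℕ → Set where
    here : ∀ {u} → Walk u u 0
    step : ∀ {u w v n} → Adj G u w → Walk w v n → Walk u v (suc n)

  data OnWalk (x : V G) : ∀ {u v n} → Walk u v n → Set where
    onHere : ∀ {u v n} {p : Walk u v n} → u ≡ x → OnWalk x p
    onStep : ∀ {u w v n} {a : Adj G u w} {p : Walk w v n} →
             OnWalk x p → OnWalk x (step a p)

  Shortest : ∀ {u v n} → Walk u v n → Set
  Shortest {u} {v} {n} _ = ∀ m → Walk u v m → n ≤ m

  OnGeodesic : V G → V G → V G → Set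
  OnGeodesic x y z = Σ ℕ λ n → Σ (Walk x z n) λ p → Shortest p × OnWalk y p

  GeneralPosition : List (V G) → Set
  GeneralPosition S = ∀ {x y z} → x ∈ S → y ∈ S → z ∈ S →
    x ≢ y → y ≢ z → x ≢ z → ¬ OnGeodesic x y z

  LegalMove : List (V G) → List (V G) → Set
  LegalMove S T = Σ (V G) λ u → Σ (V G) λ v →
    u ∈ S × v ∉ S × Adj G u v ×
    (∀ x → (x ∈ T) ⇔ ((x ∈ S × x ≢ u) ⊎ x ≡ v)) ×
    GeneralPosition T

  Mobile : List (V G) → Set
  Mobile S = GeneralPosition S × Σ (List (List (V G))) λ cs →
    Linked LegalMove (S ∷ cs) × (∀ x → Any (x ∈_) (S ∷ cs))

  MobEq : ℕ → Set
  MobEq k = (Σ (List (V G)) λ S → Unique S × Mobile S × length S ≡ k) ×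
            (∀ S → Unique S → Mobile S → length S ≤ k)

-- Distances in C4 □ P_s add up over the two factors, so a vertex lies on a geodesic between
-- two others exactly when its row lies between theirs on C4 and its column between theirs on
-- P_s.  Hence no four points of a general position set have three of them in one row, two
-- pairs sharing rows, or a pair in row a together with points in row a + 2 and in a row next
-- to a.  Any five rows contain one of these patterns, so general position sets have at most
-- four points; with four robots, a robot changing its row would create such a pattern, so
-- each robot keeps its row.  If some row is empty it is never visited.  Otherwise the robots
-- in rows 0 and 1 never share a column, since the one in row 0 would lie on a geodesic from
-- the one in row 1 to the one in row 3; so their left-to-right order never changes, and
-- column 0 of the row of the right one is never visited.  Three robots suffice: thirteen
-- legal moves within three consecutive columns visit all twelve vertices there and shift the
-- starting configuration one column to the right.

module Submission where

open import Defs
open import Data.Empty using (⊥-elim)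
open import Data.Fin as Fin using (Fin; zero; suc; toℕ; #_)
open import Data.Fin.Properties
  using (all?; any?; ¬∀⟶∃¬; toℕ-injective; toℕ-fromℕ<; toℕ<n; inject≤-injective)
open import Data.List as List
  using (List; []; _∷_; _++_; map; length; allFin; cartesianProduct; filter)
open import Data.List.Membership.Propositional using (_∈_; _∉_; find; lose)
open import Data.List.Membership.Propositional.Properties
  using (∈-map⁺; ∈-map⁻; ∈-lookup; ∈-filter⁻; ∈-allFin; ∈-cartesianProduct⁺)
open import Data.List.Relation.Unary.All as All using (All; []; _∷_)
open import Data.List.Relation.Unary.All.Properties using (All¬⇒¬Any)
open import Data.List.Relation.Unary.AllPairs using (_∷_; allPairs?)
open import Data.List.Relation.Unary.Any as Any using (Any)
open import Data.List.Relation.Unary.Any.Properties using (++⁺ˡ; ++⁺ʳ) renaming (map⁺ to Any-map⁺)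
open import Data.List.Relation.Unary.Linked as Linked using (Linked; [-]; _∷_; linked?)
open import Data.List.Relation.Unary.Linked.Properties using (++⁺) renaming (map⁺ to Linked-map⁺)
open import Data.List.Relation.Unary.Unique.Propositional using (Unique)
import Data.List.Relation.Unary.Unique.Propositional.Properties as Unique
open import Data.Maybe using (just)
open import Data.Maybe.Relation.Binary.Connected using (Connected)
open import Data.Nat as ℕ
  using (ℕ; zero; suc; _+_; _∸_; _≤_; _<_; _≤?_; _⊓_; _%_; ∣_-_∣; z≤n; s≤s)
open import Data.Nat.DivMod using (m%n<n)
open import Data.Nat.Properties
open import Algebra.Properties.CommutativeSemigroup +-commutativeSemigroup using (interchange)
open import Data.Product as Product using (Σ; ∃; ∃₂; _×_; _,_; proj₁; proj₂)
open import Data.Product.Properties using (≡-dec; ×-≡,≡→≡)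
open import Data.Sum as Sum using (_⊎_; inj₁; inj₂; [_,_])
open import Data.Unit using (⊤; tt)
open import Data.Vec using (_∷_; []; lookup; tabulate; _[_]≔_)
open import Data.Vec.Properties using (lookup∘tabulate; lookup∘update; lookup∘update′)
open import Data.Vec.Functional as Vector using (Vector; updateAt)
open import Data.Vec.Functional.Properties using (updateAt-updates; updateAt-minimal)
open import Function using (_∘_; const)
open import Function.Bundles using (_⇔_; mk⇔; Equivalence)
open import Function.Definitions using (Injective)
open import Relation.Binary.Definitions using (DecidableEquality; Symmetric; tri<; tri≈; tri>)
open import Relation.Binary.PropositionalEquality
  using (_≡_; _≢_; _≗_; refl; sym; trans; cong; cong₂; subst; subst₂; module ≡-Reasoning)
open import Relation.Nullary using (Dec; yes; no; ¬_; contradiction)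
open import Relation.Nullary.Decidable using (from-yes; map′; _×-dec_; _⊎-dec_; _→-dec_; ¬?)

-- Walks and graph distances

module _ {G : Graph} where

  infixr 5 _++ʷ_

  _++ʷ_ : ∀ {x y z m n} → Walk G x y m → Walk G y z n → Walk G x z (m + n)
  here     ++ʷ q = q
  step a p ++ʷ q = step a (p ++ʷ q)

  on-++ʷ : ∀ {x y z m n} (p : Walk G x y m) (q : Walk G y z n) → OnWalk G y (p ++ʷ q)
  on-++ʷ here       q = onHere refl
  on-++ʷ (step a p) q = onStep (on-++ʷ p q)

  split-at : ∀ {x y z n} {p : Walk G x z n} → OnWalk G y p →
             ∃₂ λ m₁ m₂ → Walk G x y m₁ × Walk G y z m₂ × m₁ + m₂ ≡ n
  split-at {p = p} (onHere refl) = 0 , _ , here , p , refl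
  split-at (onStep {a = a} on) with split-at on
  ... | m₁ , m₂ , p₁ , p₂ , e = suc m₁ , m₂ , step a p₁ , p₂ , cong suc e

  _▷_ : ∀ {x y z n} → Walk G x y n → Adj G y z → Walk G x z (suc n)
  here     ▷ b = step b here
  step a p ▷ b = step a (p ▷ b)

  reverse : Symmetric (Adj G) → ∀ {x y n} → Walk G x y n → Walk G y x n
  reverse symmetric here       = here
  reverse symmetric (step a p) = reverse symmetric p ▷ symmetric a

Between : {A : Set} → (A → A → ℕ) → A → A → A → Set
Between d x y z = d x y + d y z ≡ d x z

record IsGraphDistance (G : Graph) (d : V G → V G → ℕ) : Set where
  field
    self     : ∀ x → d x x ≡ 0
    triangle : ∀ x y z → d x z ≤ d x y + d y z
    adjacent : ∀ {x y} → Adj G x y → d x y ≤ 1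
    geodesic : ∀ x y → Walk G x y (d x y)

module GraphDistance {G : Graph} {d : V G → V G → ℕ} (isDistance : IsGraphDistance G d) where
  open IsGraphDistance isDistance

  distance≤length : ∀ {x y n} → Walk G x y n → d x y ≤ n
  distance≤length {x} here = ≤-reflexive (self x)
  distance≤length {x} {z} (step {w = w} a p) =
    ≤-trans (triangle x w z) (+-mono-≤ (adjacent a) (distance≤length p))

  onGeodesic⇔between : ∀ {x y z} → OnGeodesic G x y z ⇔ Between d x y z
  onGeodesic⇔between {x} {y} {z} = mk⇔ to from
    where
    to : OnGeodesic G x y z → Between d x y z
    to (_ , _ , shortest , on) with split-at on
    ... | _ , _ , p₁ , p₂ , refl =
      ≤-antisym (≤-trans (+-mono-≤ (distance≤length p₁) (distance≤length p₂)) (shortest _ (geodesic x z)))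
                (triangle x y z)
    from : Between d x y z → OnGeodesic G x y z
    from between = _ , geodesic x y ++ʷ geodesic y z
                 , (λ m q → subst (_≤ m) (sym between) (distance≤length q))
                 , on-++ʷ (geodesic x y) (geodesic y z)

  between-left : ∀ x z → Between d x x z
  between-left x z = cong (_+ d x z) (self x)

  between-right : ∀ x z → Between d x z z
  between-right x z = trans (cong (d x z +_) (self z)) (+-identityʳ (d x z))

_⊕_ : {A B : Set} → (A → A → ℕ) → (B → B → ℕ) → A × B → A × B → ℕ
(dA ⊕ dB) (a , b) (a′ , b′) = dA a a′ + dB b b′

between-⊕ : ∀ {A B : Set} {dA : A → A → ℕ} {dB : B → B → ℕ} {a a′ a″ b b′ b″} →
            Between dA a a′ a″ → Between dB b b′ b″ →
            Between (dA ⊕ dB) (a , b) (a′ , b′) (a″ , b″)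
between-⊕ {dA = dA} {dB} {a} {a′} {a″} {b} {b′} {b″} betweenA betweenB =
  trans (interchange (dA a a′) (dB b b′) (dA a′ a″) (dB b′ b″)) (cong₂ _+_ betweenA betweenB)

module _ {G H : Graph} where

  lift₁ : ∀ {g g′ n} h → Walk G g g′ n → Walk (G □ H) (g , h) (g′ , h) n
  lift₁ h here       = here
  lift₁ h (step a p) = step (inj₁ (refl , a)) (lift₁ h p)

  lift₂ : ∀ g {h h′ n} → Walk H h h′ n → Walk (G □ H) (g , h) (g , h′) n
  lift₂ g here       = here
  lift₂ g (step a p) = step (inj₂ (refl , a)) (lift₂ g p)

  isGraphDistance-□ : ∀ {dG dH} → IsGraphDistance G dG → IsGraphDistance H dH →
                      IsGraphDistance (G □ H) (dG ⊕ dH)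
  isGraphDistance-□ {dG} {dH} isG isH = record
    { self     = λ (g , h) → cong₂ _+_ (G.self g) (H.self h)
    ; triangle = λ (g , h) (g′ , h′) (g″ , h″) →
        ≤-trans (+-mono-≤ (G.triangle g g′ g″) (H.triangle h h′ h″))
                (≤-reflexive (interchange (dG g g′) (dG g′ g″) (dH h h′) (dH h′ h″)))
    ; adjacent = adjacent
    ; geodesic = λ (g , h) (g′ , h′) → lift₁ h (G.geodesic g g′) ++ʷ lift₂ g′ (H.geodesic h h′)
    }
    where
    module G = IsGraphDistance isG
    module H = IsGraphDistance isH
    adjacent : ∀ {x y} → Adj (G □ H) x y → (dG ⊕ dH) x y ≤ 1
    adjacent {_}     {_ , h} (inj₁ (refl , a)) = +-mono-≤ (G.adjacent a) (≤-reflexive (H.self h))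
    adjacent {g , _} {_}     (inj₂ (refl , a)) = +-mono-≤ (≤-reflexive (G.self g)) (H.adjacent a)

dPath : ∀ {s} → Fin s → Fin s → ℕ
dPath i j = ∣ toℕ i - toℕ j ∣

suc-walk : ∀ {s} {i j : Fin s} {n} → Walk (Path s) i j n → Walk (Path (suc s)) (suc i) (suc j) n
suc-walk here       = here
suc-walk (step a p) = step (Sum.map (cong suc) (cong suc) a) (suc-walk p)

walk-up : ∀ {s} (i j : Fin s) → toℕ i ≤ toℕ j → Walk (Path s) i j (toℕ j ∸ toℕ i)
walk-up               zero    zero     _         = here
walk-up {suc zero}    zero    (suc ())  _
walk-up {suc (suc s)} zero    (suc j)  _         = step (inj₁ refl) (suc-walk (walk-up zero j z≤n))
walk-up               (suc i) (suc j)  (s≤s i≤j) = suc-walk (walk-up i j i≤j)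

∣n-suc-n∣≡1 : ∀ n → ∣ n - suc n ∣ ≡ 1
∣n-suc-n∣≡1 zero    = refl
∣n-suc-n∣≡1 (suc n) = ∣n-suc-n∣≡1 n

isGraphDistance-Path : ∀ {s} → IsGraphDistance (Path s) dPath
isGraphDistance-Path {s} = record
  { self     = λ i → ∣n-n∣≡0 (toℕ i)
  ; triangle = λ i j k → ∣-∣-triangle (toℕ i) (toℕ j) (toℕ k)
  ; adjacent = adjacent
  ; geodesic = geodesic
  }
  where
  adjacent : ∀ {i j} → Adj (Path s) i j → dPath i j ≤ 1
  adjacent {i}     (inj₁ e) =
    ≤-reflexive (trans (cong (λ n → ∣ toℕ i - n ∣) e) (∣n-suc-n∣≡1 (toℕ i)))
  adjacent {_} {j} (inj₂ e) =
    ≤-reflexive (trans (cong (λ n → ∣ n - toℕ j ∣) e)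
                       (trans (∣-∣-comm (suc (toℕ j)) (toℕ j)) (∣n-suc-n∣≡1 (toℕ j))))
  geodesic : ∀ i j → Walk (Path s) i j (dPath i j)
  geodesic i j with ≤-total (toℕ i) (toℕ j)
  ... | inj₁ i≤j = subst (Walk (Path s) i j) (sym (m≤n⇒∣m-n∣≡n∸m i≤j)) (walk-up i j i≤j)
  ... | inj₂ j≤i = subst (Walk (Path s) i j) (sym (m≤n⇒∣n-m∣≡n∸m j≤i))
                         (reverse Sum.swap (walk-up j i j≤i))

dC4 : Fin 4 → Fin 4 → ℕ
dC4 a b = ∣ toℕ a - toℕ b ∣ ⊓ (4 ∸ ∣ toℕ a - toℕ b ∣)

adjacent-C4? : ∀ a b → Dec (Adj C4 a b)
adjacent-C4? a b = (toℕ b ℕ.≟ suc (toℕ a) % 4) ⊎-dec (toℕ a ℕ.≟ suc (toℕ b) % 4)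

walk-C4? : ∀ n a b → Dec (Walk C4 a b n)
walk-C4? zero    a b = map′ (λ { refl → here }) (λ { here → refl }) (a Fin.≟ b)
walk-C4? (suc n) a b = map′ (λ (w , a~w , p) → step a~w p) (λ { (step a~w p) → _ , a~w , p })
                            (any? λ w → adjacent-C4? a w ×-dec walk-C4? n w b)

isGraphDistance-C4 : IsGraphDistance C4 dC4
isGraphDistance-C4 = record
  { self     = from-yes (all? λ a → dC4 a a ℕ.≟ 0)
  ; triangle = from-yes (all? λ a → all? λ b → all? λ c → dC4 a c ≤? dC4 a b + dC4 b c)
  ; adjacent = λ {a} {b} → from-yes (all? λ a → all? λ b → adjacent-C4? a b →-dec dC4 a b ≤? 1) a b
  ; geodesic = from-yes (all? λ a → all? λ b → walk-C4? (dC4 a b) a b)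
  }

open GraphDistance isGraphDistance-C4 using (between-left; between-right)

antipode : Fin 4 → Fin 4
antipode a = Fin.fromℕ< (m%n<n (toℕ a + 2) 4)

adjacent-between-antipode : ∀ a d → Adj C4 a d → Between dC4 a d (antipode a)
adjacent-between-antipode = from-yes (all? λ a → all? λ d →
  adjacent-C4? a d →-dec (dC4 a d + dC4 d (antipode a) ℕ.≟ dC4 a (antipode a)))

adjacent-antipode-distinct : ∀ b a → Adj C4 b a → b ≢ a × a ≢ antipode b × b ≢ antipode b
adjacent-antipode-distinct = from-yes (all? λ b → all? λ a →
  adjacent-C4? b a →-dec
    (¬? (b Fin.≟ a) ×-dec ¬? (a Fin.≟ antipode b) ×-dec ¬? (b Fin.≟ antipode b)))

-- The distance of C4 □ P_s

C4□P : ℕ → Graph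
C4□P s = C4 □ Path s

distance : ∀ {s} → V (C4□P s) → V (C4□P s) → ℕ
distance = dC4 ⊕ dPath

onGeodesic⇔between : ∀ {s} {x y z : V (C4□P s)} → OnGeodesic (C4□P s) x y z ⇔ Between distance x y z
onGeodesic⇔between =
  GraphDistance.onGeodesic⇔between (isGraphDistance-□ isGraphDistance-C4 isGraphDistance-Path)

row : ∀ {s} → V (C4□P s) → Fin 4
row = proj₁

col : ∀ {s} → V (C4□P s) → ℕ
col = toℕ ∘ proj₂

_≟ᵥ_ : ∀ {s} → DecidableEquality (V (C4□P s))
_≟ᵥ_ = ≡-dec Fin._≟_ Fin._≟_

InOrder : ℕ → ℕ → ℕ → Set
InOrder x y z = (x ≤ y × y ≤ z) ⊎ (z ≤ y × y ≤ x)

StrictlyInOrder : ℕ → ℕ → ℕ → Set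
StrictlyInOrder x y z = (x < y × y < z) ⊎ (z < y × y < x)

between-∣-∣-sym : ∀ {x y z} → Between ∣_-_∣ z y x → Between ∣_-_∣ x y z
between-∣-∣-sym {x} {y} {z} between = begin
  ∣ x - y ∣ + ∣ y - z ∣ ≡⟨ cong₂ _+_ (∣-∣-comm x y) (∣-∣-comm y z) ⟩
  ∣ y - x ∣ + ∣ z - y ∣ ≡⟨ +-comm ∣ y - x ∣ ∣ z - y ∣ ⟩
  ∣ z - y ∣ + ∣ y - x ∣ ≡⟨ between ⟩
  ∣ z - x ∣             ≡⟨ ∣-∣-comm z x ⟩
  ∣ x - z ∣             ∎
  where open ≡-Reasoning

inOrder⇒between : ∀ {x y z} → InOrder x y z → Between ∣_-_∣ x y z
inOrder⇒between {x} (inj₁ (x≤y , y≤z)) with m≤n⇒∃[o]m+o≡n x≤y | m≤n⇒∃[o]m+o≡n y≤z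
... | a , refl | b , refl = begin
  ∣ x - x + a ∣ + ∣ x + a - x + a + b ∣ ≡⟨ cong₂ _+_ (∣m-m+n∣≡n x a) (∣m-m+n∣≡n (x + a) b) ⟩
  a + b                                 ≡⟨ ∣m-m+n∣≡n x (a + b) ⟨
  ∣ x - x + (a + b) ∣                   ≡⟨ cong (λ n → ∣ x - n ∣) (+-assoc x a b) ⟨
  ∣ x - x + a + b ∣                     ∎
  where open ≡-Reasoning
inOrder⇒between {x} {y} {z} (inj₂ (z≤y , y≤x)) =
  between-∣-∣-sym {x} {y} {z} (inOrder⇒between (inj₁ (z≤y , y≤x)))

between-intro : ∀ {s} {x y z : V (C4□P s)} → Between dC4 (row x) (row y) (row z) →
                InOrder (col x) (col y) (col z) → Between distance x y z
between-intro {x = a , i} {b , j} {c , k} rows cols =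
  between-⊕ {dA = dC4} {dB = dPath} {a} {b} {c} {i} {j} {k} rows (inOrder⇒between cols)

<-cycle : ∀ {x y z} → x < y → y < z → ¬ z < x
<-cycle x<y y<z z<x = <-irrefl refl (<-trans x<y (<-trans y<z z<x))

strictlyInOrder-exclusive : ∀ {x y z} → StrictlyInOrder x z y → ¬ StrictlyInOrder x y z
strictlyInOrder-exclusive (inj₁ (_ , z<y))   (inj₁ (_ , y<z))   = <-asym z<y y<z
strictlyInOrder-exclusive (inj₁ (x<z , z<y)) (inj₂ (_ , y<x))   = <-cycle x<z z<y y<x
strictlyInOrder-exclusive (inj₂ (y<z , z<x)) (inj₁ (x<y , _))   = <-cycle x<y y<z z<x
strictlyInOrder-exclusive (inj₂ (y<z , _))   (inj₂ (z<y , _))   = <-asym z<y y<z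

inside-same-side : ∀ {x y z w} → StrictlyInOrder x z y → StrictlyInOrder x w y →
                   ¬ StrictlyInOrder z x w
inside-same-side (inj₁ (x<z , _))   (inj₁ (x<w , _))   (inj₁ (z<x , _)) = <-asym x<z z<x
inside-same-side (inj₁ (x<z , _))   (inj₁ (x<w , _))   (inj₂ (w<x , _)) = <-asym x<w w<x
inside-same-side (inj₂ (_ , z<x))   (inj₂ (_ , w<x))   (inj₁ (_ , x<w)) = <-asym x<w w<x
inside-same-side (inj₂ (_ , z<x))   (inj₂ (_ , w<x))   (inj₂ (_ , x<z)) = <-asym x<z z<x
inside-same-side (inj₁ (x<z , z<y)) (inj₂ (y<w , w<x)) _ = <-asym (<-trans x<z z<y) (<-trans y<w w<x)
inside-same-side (inj₂ (y<z , z<x)) (inj₁ (x<w , w<y)) _ = <-asym (<-trans x<w w<y) (<-trans y<z z<x)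

inside-either : ∀ {x y z w} → StrictlyInOrder x z y → StrictlyInOrder x w y →
                InOrder x w z ⊎ InOrder y w z
inside-either {z = z} {w} (inj₁ (x<z , z<y)) (inj₁ (x<w , w<y)) with ≤-total w z
... | inj₁ w≤z = inj₁ (inj₁ (<⇒≤ x<w , w≤z))
... | inj₂ z≤w = inj₂ (inj₂ (z≤w , <⇒≤ w<y))
inside-either {z = z} {w} (inj₂ (y<z , z<x)) (inj₂ (y<w , w<x)) with ≤-total w z
... | inj₁ w≤z = inj₂ (inj₁ (<⇒≤ y<w , w≤z))
... | inj₂ z≤w = inj₁ (inj₂ (z≤w , <⇒≤ w<x))
inside-either (inj₁ (x<z , z<y)) (inj₂ (y<w , w<x)) =
  contradiction (<-trans y<w w<x) (<-asym (<-trans x<z z<y))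
inside-either (inj₂ (y<z , z<x)) (inj₁ (x<w , w<y)) =
  contradiction (<-trans y<z z<x) (<-asym (<-trans x<w w<y))

ColumnStep : ℕ → ℕ → Set
ColumnStep x x′ = x′ ≡ suc x ⊎ x ≡ suc x′

step-below : ∀ {x x′ y} → x < y → ColumnStep x x′ → x′ ≢ y → x′ < y
step-below x<y (inj₁ refl) x′≢y = ≤∧≢⇒< x<y x′≢y
step-below x<y (inj₂ refl) _    = <-trans (n<1+n _) x<y

step-above : ∀ {x y y′} → x < y → ColumnStep y y′ → x ≢ y′ → x < y′
step-above x<y (inj₁ refl) _    = <-trans x<y (n<1+n _)
step-above x<y (inj₂ refl) x≢y′ = ≤∧≢⇒< (<⇒≤pred x<y) x≢y′

-- Row patterns that four points in general position cannot have

data Forbidden (a b c d : Fin 4) : Set where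
  three-in-a-row         : a ≡ b → b ≡ c → Forbidden a b c d
  two-pairs              : a ≡ b → c ≡ d → Forbidden a b c d
  pair-antipode-adjacent : a ≡ b → c ≡ antipode a → Adj C4 a d → Forbidden a b c d

forbidden? : ∀ a b c d → Dec (Forbidden a b c d)
forbidden? a b c d = map′ from to
  (      (a Fin.≟ b ×-dec b Fin.≟ c)
   ⊎-dec (a Fin.≟ b ×-dec c Fin.≟ d)
   ⊎-dec (a Fin.≟ b ×-dec c Fin.≟ antipode a ×-dec adjacent-C4? a d))
  where
  from = λ where
    (inj₁ (a≡b , b≡c))               → three-in-a-row a≡b b≡c
    (inj₂ (inj₁ (a≡b , c≡d)))        → two-pairs a≡b c≡d
    (inj₂ (inj₂ (a≡b , c≡a′ , a~d))) → pair-antipode-adjacent a≡b c≡a′ a~d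
  to = λ where
    (three-in-a-row a≡b b≡c)              → inj₁ (a≡b , b≡c)
    (two-pairs a≡b c≡d)                   → inj₂ (inj₁ (a≡b , c≡d))
    (pair-antipode-adjacent a≡b c≡a′ a~d) → inj₂ (inj₂ (a≡b , c≡a′ , a~d))

Quadruple : ℕ → Set
Quadruple n = Fin n × Fin n × Fin n × Fin n

Distinct : ∀ {n} → Quadruple n → Set
Distinct (i , j , k , l) = i ≢ j × i ≢ k × i ≢ l × j ≢ k × j ≢ l × k ≢ l

distinct? : ∀ {n} (t : Quadruple n) → Dec (Distinct t)
distinct? (i , j , k , l) = ¬? (i Fin.≟ j) ×-dec ¬? (i Fin.≟ k) ×-dec ¬? (i Fin.≟ l)
                      ×-dec ¬? (j Fin.≟ k) ×-dec ¬? (j Fin.≟ l) ×-dec ¬? (k Fin.≟ l)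

ForbiddenAt : ∀ {n} → Vector (Fin 4) n → Quadruple n → Set
ForbiddenAt r (i , j , k , l) = Forbidden (r i) (r j) (r k) (r l)

ForbiddenIn : ∀ {n} → Vector (Fin 4) n → Set
ForbiddenIn r = ∃ λ t → Distinct t × ForbiddenAt r t

ForbiddenIn-resp : ∀ {n} {r r′ : Vector (Fin 4) n} → r ≗ r′ → ForbiddenIn r → ForbiddenIn r′
ForbiddenIn-resp r≗r′ ((i , j , k , l) , distinct , forbidden)
  rewrite r≗r′ i | r≗r′ j | r≗r′ k | r≗r′ l = (i , j , k , l) , distinct , forbidden

quadruples : ∀ n → List (Quadruple n)
quadruples n = cartesianProduct all (cartesianProduct all (cartesianProduct all all))
  where all = allFin n

arrangements : ∀ n → List (Quadruple n)
arrangements n = filter distinct? (quadruples n)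

search? : ∀ {n} (r : Vector (Fin 4) n) → Dec (Any (ForbiddenAt r) (arrangements n))
search? r = Any.any? (λ (i , j , k , l) → forbidden? (r i) (r j) (r k) (r l)) _

search-sound : ∀ {n} {r : Vector (Fin 4) n} → Any (ForbiddenAt r) (arrangements n) → ForbiddenIn r
search-sound {n} found with find found
... | t , t∈ , forbidden = t , proj₂ (∈-filter⁻ distinct? {xs = quadruples n} t∈) , forbidden

five-rows-forbidden : ∀ (r : Vector (Fin 4) 5) → ForbiddenIn r
five-rows-forbidden r = ForbiddenIn-resp (lookup∘tabulate r) (search-sound
  (by-computation (r (# 0)) (r (# 1)) (r (# 2)) (r (# 3)) (r (# 4))))
  where
  by-computation : ∀ a b c d e → Any (ForbiddenAt (lookup (a ∷ b ∷ c ∷ d ∷ e ∷ []))) (arrangements 5)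
  by-computation = from-yes (all? λ a → all? λ b → all? λ c → all? λ d → all? λ e →
    search? (lookup (a ∷ b ∷ c ∷ d ∷ e ∷ [])))

row-step-forbidden : ∀ (r r′ : Vector (Fin 4) 4) m → (∀ j → j ≢ m → r′ j ≡ r j) → Adj C4 (r m) (r′ m) →
                     ForbiddenIn r ⊎ ForbiddenIn r′
row-step-forbidden r r′ m unchanged r~r′ =
  Sum.map (ForbiddenIn-resp (lookup∘tabulate r) ∘ search-sound) (ForbiddenIn-resp updated ∘ search-sound)
          (by-computation (r (# 0)) (r (# 1)) (r (# 2)) (r (# 3)) m (r′ m)
                          (subst (λ a → Adj C4 a (r′ m)) (sym (lookup∘tabulate r m)) r~r′))
  where
  by-computation : ∀ a b c d m x → Adj C4 (lookup (a ∷ b ∷ c ∷ d ∷ []) m) x →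
                   Any (ForbiddenAt (lookup (a ∷ b ∷ c ∷ d ∷ []))) (arrangements 4)
                   ⊎ Any (ForbiddenAt (lookup ((a ∷ b ∷ c ∷ d ∷ []) [ m ]≔ x))) (arrangements 4)
  by-computation = from-yes (all? λ a → all? λ b → all? λ c → all? λ d → all? λ m → all? λ x →
    adjacent-C4? (lookup (a ∷ b ∷ c ∷ d ∷ []) m) x →-dec
      (search? (lookup (a ∷ b ∷ c ∷ d ∷ [])) ⊎-dec search? (lookup ((a ∷ b ∷ c ∷ d ∷ []) [ m ]≔ x))))
  updated : lookup (tabulate r [ m ]≔ r′ m) ≗ r′
  updated j with j Fin.≟ m
  ... | yes refl = lookup∘update j (tabulate r) (r′ j)
  ... | no j≢m   =
        trans (lookup∘update′ j≢m (tabulate r) (r′ m)) (trans (lookup∘tabulate r j) (sym (unchanged j j≢m)))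

DistinctMembers : ∀ {A : Set} {n} → List A → Vector A n → Set
DistinctMembers C p = Injective _≡_ _≡_ p × (∀ j → p j ∈ C)

module _ {s n} {C : List (V (C4□P s))} (gp : GeneralPosition (C4□P s) C)
         {p : Vector (V (C4□P s)) n} (members : DistinctMembers C p) where

  private
    p-injective : Injective _≡_ _≡_ p
    p-injective = proj₁ members

    p∈C : ∀ j → p j ∈ C
    p∈C = proj₂ members

  not-between : ∀ {a b c} → a ≢ b → b ≢ c → a ≢ c →
                Between dC4 (row (p a)) (row (p b)) (row (p c)) → ¬ InOrder (col (p a)) (col (p b)) (col (p c))
  not-between {a} {b} {c} a≢b b≢c a≢c rows cols =
    gp (p∈C a) (p∈C b) (p∈C c) (a≢b ∘ p-injective) (b≢c ∘ p-injective) (a≢c ∘ p-injective)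
       (Equivalence.from onGeodesic⇔between (between-intro {x = p a} {p b} {p c} rows cols))

  column-inside-< : ∀ {a b c} → a ≢ b → c ≢ a → c ≢ b → row (p a) ≡ row (p b) → col (p a) < col (p b) →
                    col (p a) < col (p c) × col (p c) < col (p b)
  column-inside-< {a} {b} {c} a≢b c≢a c≢b same a<b =
      ≰⇒> (λ c≤a → not-between c≢a a≢b c≢b a-between (inj₁ (c≤a , <⇒≤ a<b)))
    , ≰⇒> (λ b≤c → not-between a≢b (c≢b ∘ sym) (c≢a ∘ sym) b-between (inj₁ (<⇒≤ a<b , b≤c)))
    where
    a-between : Between dC4 (row (p c)) (row (p a)) (row (p b))
    a-between = subst (λ r → Between dC4 (row (p c)) r (row (p b))) (sym same)
                      (between-right (row (p c)) (row (p b)))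
    b-between : Between dC4 (row (p a)) (row (p b)) (row (p c))
    b-between = subst (λ r → Between dC4 r (row (p b)) (row (p c))) (sym same)
                      (between-left (row (p b)) (row (p c)))

  column-inside : ∀ {a b c} → a ≢ b → c ≢ a → c ≢ b → row (p a) ≡ row (p b) →
                  StrictlyInOrder (col (p a)) (col (p c)) (col (p b))
  column-inside {a} {b} a≢b c≢a c≢b same with <-cmp (col (p a)) (col (p b))
  ... | tri< a<b _ _ = inj₁ (column-inside-< a≢b c≢a c≢b same a<b)
  ... | tri≈ _ a≡b _ = contradiction (p-injective (×-≡,≡→≡ (same , toℕ-injective a≡b))) a≢b
  ... | tri> _ _ b<a = inj₂ (column-inside-< (a≢b ∘ sym) c≢b c≢a (sym same) b<a)

  no-forbidden-rows : ¬ ForbiddenIn (row ∘ p)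
  no-forbidden-rows ((i , j , k , l) , (i≢j , i≢k , i≢l , j≢k , j≢l , k≢l) , forbidden) with forbidden
  ... | three-in-a-row i~j j~k =
        strictlyInOrder-exclusive (column-inside i≢j (i≢k ∘ sym) (j≢k ∘ sym) i~j)
                                  (column-inside i≢k (i≢j ∘ sym) j≢k (trans i~j j~k))
  ... | two-pairs i~j k~l =
        inside-same-side (column-inside i≢j (i≢k ∘ sym) (j≢k ∘ sym) i~j)
                         (column-inside i≢j (i≢l ∘ sym) (j≢l ∘ sym) i~j)
                         (column-inside k≢l i≢k i≢l k~l)
  ... | pair-antipode-adjacent i~j k~i′ i~l
        with inside-either (column-inside i≢j (i≢k ∘ sym) (j≢k ∘ sym) i~j)
                           (column-inside i≢j (i≢l ∘ sym) (j≢l ∘ sym) i~j)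
  ...   | inj₁ cols = not-between i≢l (k≢l ∘ sym) i≢k rows-i cols
    where
    rows-i : Between dC4 (row (p i)) (row (p l)) (row (p k))
    rows-i = subst (Between dC4 (row (p i)) (row (p l))) (sym k~i′) (adjacent-between-antipode _ _ i~l)
  ...   | inj₂ cols = not-between j≢l (k≢l ∘ sym) j≢k rows-j cols
    where
    rows-j : Between dC4 (row (p j)) (row (p l)) (row (p k))
    rows-j = subst (λ r → Between dC4 r (row (p l)) (row (p k))) i~j
               (subst (Between dC4 (row (p i)) (row (p l))) (sym k~i′) (adjacent-between-antipode _ _ i~l))

-- Four robots keep their rows

∷-injective : ∀ {A : Set} {n} {x : A} {p : Vector A n} → (∀ j → x ≢ p j) → Injective _≡_ _≡_ p →
              Injective _≡_ _≡_ (x Vector.∷ p)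
∷-injective new p-injective {zero}  {zero}  _  = refl
∷-injective new p-injective {zero}  {suc j} eq = contradiction eq (new j)
∷-injective new p-injective {suc i} {zero}  eq = contradiction (sym eq) (new i)
∷-injective new p-injective {suc i} {suc j} eq = cong suc (p-injective eq)

updateAt-injective : ∀ {A : Set} {n} {p : Vector A n} {m v} → (∀ j → j ≢ m → v ≢ p j) →
                     Injective _≡_ _≡_ p → Injective _≡_ _≡_ (updateAt p m (const v))
updateAt-injective {p = p} {m} new p-injective {i} {j} eq with i Fin.≟ m | j Fin.≟ m
... | yes refl | yes refl = refl
... | yes refl | no j≢m   =
      contradiction (trans (sym (updateAt-updates i p)) (trans eq (updateAt-minimal j i p j≢m))) (new j j≢m)
... | no i≢m   | yes refl =
      contradiction (trans (sym (updateAt-updates j p)) (trans (sym eq) (updateAt-minimal i j p i≢m))) (new i i≢m)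
... | no i≢m   | no j≢m   =
      p-injective (trans (sym (updateAt-minimal i m p i≢m)) (trans eq (updateAt-minimal j m p j≢m)))

no-fifth-point : ∀ {s} {C : List (V (C4□P s))} {q : Vector (V (C4□P s)) 4} {w} →
                 GeneralPosition (C4□P s) C → DistinctMembers C q → w ∈ C → ∃ λ j → w ≡ q j
no-fifth-point {C = C} {q} {w} gp (q-injective , q∈C) w∈C with any? (λ j → w ≟ᵥ q j)
... | yes w∈q = w∈q
... | no  w∉q = contradiction (five-rows-forbidden (row ∘ (w Vector.∷ q)))
                  (no-forbidden-rows gp (∷-injective (λ j e → w∉q (j , e)) q-injective , members))
  where
  members : ∀ j → (w Vector.∷ q) j ∈ C
  members zero    = w∈C
  members (suc j) = q∈C j

OrderPreserving : ∀ {s n} → Vector (V (C4□P s)) n → Vector (V (C4□P s)) n → Set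
OrderPreserving q q′ = ∀ i j → col (q i) < col (q j) → col (q′ i) ≢ col (q′ j) → col (q′ i) < col (q′ j)

updateAt-orderPreserving : ∀ {s n} (q : Vector (V (C4□P s)) n) m v → ColumnStep (col (q m)) (col v) →
                           OrderPreserving q (updateAt q m (const v))
updateAt-orderPreserving q m v moved i j q<q with i Fin.≟ m | j Fin.≟ m
... | yes refl | yes refl = contradiction q<q (<-irrefl refl)
... | yes refl | no j≢m
  rewrite updateAt-updates i {const v} q | updateAt-minimal j i {const v} q j≢m = step-below q<q moved
... | no i≢m   | yes refl
  rewrite updateAt-minimal i j {const v} q i≢m | updateAt-updates j {const v} q = step-above q<q moved
... | no i≢m   | no j≢m
  rewrite updateAt-minimal i m {const v} q i≢m | updateAt-minimal j m {const v} q j≢m = λ _ → q<q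

linked-invariant : ∀ {A : Set} {R : A → A → Set} {P : A → Set} → (∀ {x y} → R x y → P x → P y) →
                   ∀ {x xs} → Linked R (x ∷ xs) → P x → All P (x ∷ xs)
linked-invariant preserve [-]      px = px ∷ []
linked-invariant preserve (r ∷ rs) px = px ∷ linked-invariant preserve rs (preserve r px)

module _ {s : ℕ} where

  move-tracked : ∀ {C C′ : List (V (C4□P s))} {q} → LegalMove (C4□P s) C C′ → GeneralPosition (C4□P s) C →
                 DistinctMembers C q →
                 ∃ λ q′ → DistinctMembers C′ q′ × (∀ j → row (q′ j) ≡ row (q j)) × OrderPreserving q q′
  move-tracked {C} {C′} {q} (u , v , u∈C , v∉C , u~v , C′-members , gp′) gp (q-injective , q∈C)
    with any? (λ j → u ≟ᵥ q j)
  ... | no u∉q = q , (q-injective , stays) , (λ _ → refl) , (λ _ _ q<q _ → q<q)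
    where
    stays : ∀ j → q j ∈ C′
    stays j = Equivalence.from (C′-members (q j)) (inj₁ (q∈C j , λ e → u∉q (j , sym e)))
  ... | yes (m , refl) = q′ , members′ , rows′ , updateAt-orderPreserving q m v (proj₂ vertical)
    where
    q′ = updateAt q m (const v)
    members′ : DistinctMembers C′ q′
    members′ = updateAt-injective {m = m} {v} (λ j _ v≡qj → v∉C (subst (_∈ C) (sym v≡qj) (q∈C j))) q-injective
             , member
      where
      member : ∀ j → q′ j ∈ C′
      member j with j Fin.≟ m
      ... | yes refl rewrite updateAt-updates j {const v} q = Equivalence.from (C′-members v) (inj₂ refl)
      ... | no j≢m   rewrite updateAt-minimal j m {const v} q j≢m =
            Equivalence.from (C′-members (q j)) (inj₁ (q∈C j , j≢m ∘ q-injective))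
    vertical : row v ≡ row (q m) × ColumnStep (col (q m)) (col v)
    vertical = classify u~v
      where
      classify : Adj (C4□P s) (q m) v → row v ≡ row (q m) × ColumnStep (col (q m)) (col v)
      classify (inj₂ (same-row , column-step)) = sym same-row , column-step
      classify (inj₁ (_ , row-step)) = ⊥-elim (not-forbidden forbidden)
        where
        not-forbidden : ¬ (ForbiddenIn (row ∘ q) ⊎ ForbiddenIn (row ∘ q′))
        not-forbidden = [ no-forbidden-rows gp (q-injective , q∈C) , no-forbidden-rows gp′ members′ ]
        forbidden : ForbiddenIn (row ∘ q) ⊎ ForbiddenIn (row ∘ q′)
        forbidden = row-step-forbidden (row ∘ q) (row ∘ q′) m (λ j j≢m → cong row (updateAt-minimal j m q j≢m))
                                       (subst (Adj C4 (row (q m))) (sym (cong row (updateAt-updates m q))) row-step)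
    rows′ : ∀ j → row (q′ j) ≡ row (q j)
    rows′ j with j Fin.≟ m
    ... | yes refl rewrite updateAt-updates j {const v} q = proj₁ vertical
    ... | no j≢m   rewrite updateAt-minimal j m {const v} q j≢m = refl

  Tracked : Vector (Fin 4) 4 → (Vector (V (C4□P s)) 4 → Set) → List (V (C4□P s)) → Set
  Tracked R E C = GeneralPosition (C4□P s) C × ∃ λ q → DistinctMembers C q × (∀ j → row (q j) ≡ R j) × E q

  Preserved : Vector (Fin 4) 4 → (Vector (V (C4□P s)) 4 → Set) → Set
  Preserved R E = ∀ C {q q′} → GeneralPosition (C4□P s) C → DistinctMembers C q′ → (∀ j → row (q′ j) ≡ R j) →
                  OrderPreserving q q′ → E q → E q′

  tracked-step : ∀ {R E} → Preserved R E → ∀ {C C′} → LegalMove (C4□P s) C C′ → Tracked R E C → Tracked R E C′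
  tracked-step preserved move@(_ , _ , _ , _ , _ , _ , gp′) (gp , q , members , rows , e)
    with move-tracked move gp members
  ... | q′ , members′ , rows′ , order = gp′ , q′ , members′ , rows″ , preserved _ gp′ members′ rows″ order e
    where rows″ = λ j → trans (rows′ j) (rows j)

  unvisited : ∀ {R E w S cs} → Preserved R E → (∀ {C} → Tracked R E C → w ∉ C) →
              Linked (LegalMove (C4□P s)) (S ∷ cs) → Tracked R E S → ¬ Any (w ∈_) (S ∷ cs)
  unvisited preserved excluded chain tracked =
    All¬⇒¬Any (All.map excluded (linked-invariant (tracked-step preserved) chain tracked))

-- No mobile general position set has four points

rows-apart : ∀ {s n} {q : Vector (V (C4□P s)) n} {i j a b} → row (q i) ≡ a → row (q j) ≡ b → a ≢ b → i ≢ j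
rows-apart qi qj a≢b refl = a≢b (trans (sym qi) qj)

adjacent-rows-distinct-columns : ∀ {s C} {q : Vector (V (C4□P s)) 4} {a b i j k} →
  GeneralPosition (C4□P s) C → DistinctMembers C q →
  Adj C4 b a → row (q i) ≡ a → row (q j) ≡ b → row (q k) ≡ antipode b → col (q i) ≢ col (q j)
adjacent-rows-distinct-columns {q = q} {a} {b} {i} {j} {k} gp members b~a qi qj qk i≡j =
  not-between gp members (rows-apart {q = q} qj qi b≢a) (rows-apart {q = q} qi qk a≢b′)
                         (rows-apart {q = q} qj qk b≢b′) rows cols
  where
  b≢a = proj₁ (adjacent-antipode-distinct b a b~a)
  a≢b′ = proj₁ (proj₂ (adjacent-antipode-distinct b a b~a))
  b≢b′ = proj₂ (proj₂ (adjacent-antipode-distinct b a b~a))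
  rows : Between dC4 (row (q j)) (row (q i)) (row (q k))
  rows rewrite qi | qj | qk = adjacent-between-antipode b a b~a
  cols : InOrder (col (q j)) (col (q i)) (col (q k))
  cols with ≤-total (col (q j)) (col (q k))
  ... | inj₁ j≤k = inj₁ (≤-reflexive (sym i≡j) , subst (_≤ col (q k)) (sym i≡j) j≤k)
  ... | inj₂ k≤j = inj₂ (subst (col (q k) ≤_) (sym i≡j) k≤j , ≤-reflexive i≡j)

module _ {n : ℕ} where

  missing-row-unvisited : ∀ {R x S cs} → (∀ j → R j ≢ x) → Linked (LegalMove (C4□P (suc n))) (S ∷ cs) →
                          Tracked R (λ _ → ⊤) S → ¬ Any ((x , zero) ∈_) (S ∷ cs)
  missing-row-unvisited {R} {x} missing = unvisited (λ _ _ _ _ _ _ → tt) excluded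
    where
    excluded : ∀ {C} → Tracked R (λ _ → ⊤) C → (x , zero) ∉ C
    excluded (gp , q , members , rows , _) x∈C with no-fifth-point gp members x∈C
    ... | j , x≡qj = missing j (trans (sym (rows j)) (sym (cong row x≡qj)))

  -- The robots in the adjacent rows a and b never share a column, so the one in row b stays to
  -- the right of the one in row a; a second robot in row b would complete a forbidden pattern
  -- with the robots in rows antipode b and a.
  ordered-rows-unvisited : ∀ {R a b i j k S cs} → Adj C4 b a → R i ≡ a → R j ≡ b → R k ≡ antipode b →
                           Linked (LegalMove (C4□P (suc n))) (S ∷ cs) → Tracked R (λ q → col (q i) < col (q j)) S →
                           ¬ Any ((b , zero) ∈_) (S ∷ cs)
  ordered-rows-unvisited {R} {a} {b} {i} {j} {k} b~a Ri Rj Rk = unvisited preserved excluded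
    where
    preserved : Preserved {suc n} R (λ q → col (q i) < col (q j))
    preserved _ gp members rows order i<j =
      order i j i<j (adjacent-rows-distinct-columns gp members b~a
                                                    (trans (rows i) Ri) (trans (rows j) Rj) (trans (rows k) Rk))
    excluded : ∀ {C} → Tracked R (λ q → col (q i) < col (q j)) C → (b , zero) ∉ C
    excluded (gp , q , members , rows , i<j) b∈C with no-fifth-point gp members b∈C
    ... | j′ , b≡qj′ with j′ Fin.≟ j
    ...   | yes refl = n≮0 (subst (col (q i) <_) (sym (cong col b≡qj′)) i<j)
    ...   | no j′≢j  = no-forbidden-rows gp members
            ( (j′ , j , k , i)
            , ( j′≢j , rows-apart {q = q} qj′ qk b≢b′ , rows-apart {q = q} qj′ qi b≢a
              , rows-apart {q = q} qj qk b≢b′ , rows-apart {q = q} qj qi b≢a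
              , rows-apart {q = q} qk qi (a≢b′ ∘ sym))
            , pair-antipode-adjacent (trans qj′ (sym qj)) (trans qk (cong antipode (sym qj′)))
                                     (subst₂ (Adj C4) (sym qj′) (sym qi) b~a))
      where
      qi = trans (rows i) Ri
      qj = trans (rows j) Rj
      qk = trans (rows k) Rk
      qj′ = sym (cong row b≡qj′)
      b≢a = proj₁ (adjacent-antipode-distinct b a b~a)
      a≢b′ = proj₁ (proj₂ (adjacent-antipode-distinct b a b~a))
      b≢b′ = proj₂ (proj₂ (adjacent-antipode-distinct b a b~a))

  no-mobile-quadruple : ∀ {S cs} {q : Vector (V (C4□P (suc n))) 4} → GeneralPosition (C4□P (suc n)) S →
                        DistinctMembers S q → Linked (LegalMove (C4□P (suc n))) (S ∷ cs) →
                        ¬ (∀ x → Any (x ∈_) (S ∷ cs))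
  no-mobile-quadruple {q = q} gp members chain covered with all? (λ x → any? λ j → row (q j) Fin.≟ x)
  ... | no not-all with ¬∀⟶∃¬ 4 _ (λ x → any? λ j → row (q j) Fin.≟ x) not-all
  ...   | x , missing =
          missing-row-unvisited (λ j e → missing (j , e)) chain (gp , q , members , (λ _ → refl) , tt)
                                (covered (x , zero))
  no-mobile-quadruple {q = q} gp members chain covered
      | yes all-rows with all-rows (# 0) | all-rows (# 1) | all-rows (# 2) | all-rows (# 3)
  ... | i₀ , r₀ | i₁ , r₁ | i₂ , r₂ | i₃ , r₃ with <-cmp (col (q i₀)) (col (q i₁))
  ...   | tri< lt _ _ = ordered-rows-unvisited (inj₂ refl) r₀ r₁ r₃ chain (gp , q , members , (λ _ → refl) , lt)
                                               (covered (# 1 , zero))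
  ...   | tri≈ _ eq _ = adjacent-rows-distinct-columns gp members (inj₂ refl) r₀ r₁ r₃ eq
  ...   | tri> _ _ gt = ordered-rows-unvisited (inj₁ refl) r₁ r₀ r₂ chain (gp , q , members , (λ _ → refl) , gt)
                                               (covered (# 0 , zero))

lookup-injective : ∀ {A : Set} {xs : List A} → Unique xs → Injective _≡_ _≡_ (List.lookup xs)
lookup-injective (_ ∷ _)      {zero}  {zero}  _  = refl
lookup-injective (x≢ ∷ _)     {zero}  {suc j} eq = contradiction eq (All.lookup x≢ (∈-lookup j))
lookup-injective (x≢ ∷ _)     {suc i} {zero}  eq = contradiction (sym eq) (All.lookup x≢ (∈-lookup i))
lookup-injective (_ ∷ unique) {suc i} {suc j} eq = cong suc (lookup-injective unique eq)

mobile-size≤3 : ∀ {n S} → Unique S → Mobile (C4□P (suc n)) S → length S ≤ 3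
mobile-size≤3 {S = S} unique (gp , _ , chain , covered) with 4 ≤? length S
... | no  4≰length = ≤-pred (≰⇒> 4≰length)
... | yes 4≤length = ⊥-elim (no-mobile-quadruple gp members chain covered)
  where
  members : DistinctMembers S (λ j → List.lookup S (Fin.inject≤ j 4≤length))
  members = (λ eq → inject≤-injective _ _ _ _ (lookup-injective unique eq))
          , λ j → ∈-lookup (Fin.inject≤ j 4≤length)

-- A mobile general position set of three points

_⇔?_ : ∀ {A B : Set} → Dec A → Dec B → Dec (A ⇔ B)
a? ⇔? b? = map′ (λ (f , g) → mk⇔ f g) (λ e → Equivalence.to e , Equivalence.from e)
                ((a? →-dec b?) ×-dec (b? →-dec a?))

module FiniteGraph (G : Graph) (vertices : List (V G)) (complete : ∀ x → x ∈ vertices)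
                   (_≟_ : DecidableEquality (V G)) (adjacent? : ∀ x y → Dec (Adj G x y))
                   (onGeodesic? : ∀ x y z → Dec (OnGeodesic G x y z)) where

  open import Data.List.Membership.DecPropositional _≟_ using (_∈?_)

  ∀? : {P : V G → Set} → (∀ x → Dec (P x)) → Dec (∀ x → P x)
  ∀? P? = map′ (λ all x → All.lookup all (complete x)) (λ all → All.tabulate λ {x} _ → all x)
               (All.all? P? vertices)

  ∃? : {P : V G → Set} → (∀ x → Dec (P x)) → Dec (∃ P)
  ∃? P? = map′ (λ any → let (x , _ , px) = find any in x , px) (λ (x , px) → lose (complete x) px)
               (Any.any? P? vertices)

  generalPosition? : ∀ S → Dec (GeneralPosition G S)
  generalPosition? S =
    map′ (λ all x∈ y∈ z∈ → All.lookup (All.lookup (All.lookup all x∈) y∈) z∈)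
         (λ gp → All.tabulate λ x∈ → All.tabulate λ y∈ → All.tabulate λ z∈ → gp x∈ y∈ z∈)
         (All.all? (λ x → All.all? (λ y → All.all? (λ z →
            ¬? (x ≟ y) →-dec ¬? (y ≟ z) →-dec ¬? (x ≟ z) →-dec ¬? (onGeodesic? x y z)) S) S) S)

  legalMove? : ∀ S T → Dec (LegalMove G S T)
  legalMove? S T = ∃? λ u → ∃? λ v →
    u ∈? S ×-dec ¬? (v ∈? S) ×-dec adjacent? u v ×-dec
    ∀? (λ x → (x ∈? T) ⇔? ((x ∈? S ×-dec ¬? (x ≟ u)) ⊎-dec x ≟ v)) ×-dec generalPosition? T

  covers? : ∀ cs → Dec (∀ x → Any (x ∈_) cs)
  covers? cs = ∀? λ x → Any.any? (x ∈?_) cs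

adjacent? : ∀ {s} (x y : V (C4□P s)) → Dec (Adj (C4□P s) x y)
adjacent? (a , i) (b , j) =
  (i Fin.≟ j ×-dec adjacent-C4? a b) ⊎-dec (a Fin.≟ b ×-dec (toℕ j ℕ.≟ suc (toℕ i) ⊎-dec toℕ i ℕ.≟ suc (toℕ j)))

onGeodesic? : ∀ {s} (x y z : V (C4□P s)) → Dec (OnGeodesic (C4□P s) x y z)
onGeodesic? x y z = map′ (Equivalence.from onGeodesic⇔between) (Equivalence.to onGeodesic⇔between)
                         (distance x y + distance y z ℕ.≟ distance x z)

open FiniteGraph (C4□P 3) (cartesianProduct (allFin 4) (allFin 3))
                 (λ (a , j) → ∈-cartesianProduct⁺ (∈-allFin a) (∈-allFin j)) _≟ᵥ_ adjacent? onGeodesic?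

-- Found by breadth-first search: thirteen legal moves in C4 □ P_3 that visit all twelve
-- vertices and end in sweep-start shifted one column to the right.
sweep-start : List (V (C4□P 3))
sweep-start = (# 0 , # 0) ∷ (# 1 , # 1) ∷ (# 2 , # 0) ∷ []

sweep-end : List (V (C4□P 3))
sweep-end = (# 0 , # 1) ∷ (# 1 , # 2) ∷ (# 2 , # 1) ∷ []

sweep : List (List (V (C4□P 3)))
sweep =
  ((# 0 , # 0) ∷ (# 1 , # 2) ∷ (# 2 , # 0) ∷ []) ∷
  ((# 0 , # 0) ∷ (# 1 , # 2) ∷ (# 2 , # 1) ∷ []) ∷
  ((# 0 , # 0) ∷ (# 0 , # 2) ∷ (# 2 , # 1) ∷ []) ∷
  ((# 0 , # 0) ∷ (# 2 , # 1) ∷ (# 3 , # 2) ∷ []) ∷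
  ((# 0 , # 0) ∷ (# 1 , # 1) ∷ (# 3 , # 2) ∷ []) ∷
  ((# 1 , # 1) ∷ (# 3 , # 0) ∷ (# 3 , # 2) ∷ []) ∷
  ((# 1 , # 1) ∷ (# 2 , # 2) ∷ (# 3 , # 0) ∷ []) ∷
  ((# 1 , # 0) ∷ (# 2 , # 2) ∷ (# 3 , # 0) ∷ []) ∷
  ((# 1 , # 0) ∷ (# 2 , # 2) ∷ (# 3 , # 1) ∷ []) ∷
  ((# 2 , # 0) ∷ (# 2 , # 2) ∷ (# 3 , # 1) ∷ []) ∷
  ((# 0 , # 1) ∷ (# 2 , # 0) ∷ (# 2 , # 2) ∷ []) ∷
  ((# 0 , # 1) ∷ (# 1 , # 2) ∷ (# 2 , # 0) ∷ []) ∷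
  sweep-end ∷ []

sweep-legal : Linked (LegalMove (C4□P 3)) (sweep-start ∷ sweep)
sweep-legal = from-yes (linked? legalMove? (sweep-start ∷ sweep))

sweep-covers : ∀ x → Any (x ∈_) sweep
sweep-covers = from-yes (covers? sweep)

sweep-start-unique : Unique sweep-start
sweep-start-unique = from-yes (allPairs? (λ x y → ¬? (x ≟ᵥ y)) sweep-start)

sweep-start-generalPosition : GeneralPosition (C4□P 3) sweep-start
sweep-start-generalPosition = from-yes (generalPosition? sweep-start)

module Embedding {G H : Graph} {f : V G → V H} (f-injective : Injective _≡_ _≡_ f)
                 (f-adjacent : ∀ {x y} → Adj G x y → Adj H (f x) (f y))
                 (f-reflects : ∀ {x y z} → OnGeodesic H (f x) (f y) (f z) → OnGeodesic G x y z) where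

  map-generalPosition : ∀ {S} → GeneralPosition G S → GeneralPosition H (map f S)
  map-generalPosition gp x∈ y∈ z∈ x≢y y≢z x≢z geodesic
    with ∈-map⁻ f x∈ | ∈-map⁻ f y∈ | ∈-map⁻ f z∈
  ... | _ , x∈S , refl | _ , y∈S , refl | _ , z∈S , refl =
    gp x∈S y∈S z∈S (x≢y ∘ cong f) (y≢z ∘ cong f) (x≢z ∘ cong f) (f-reflects geodesic)

  map-legalMove : ∀ {S T} → LegalMove G S T → LegalMove H (map f S) (map f T)
  map-legalMove {S} {T} (u , v , u∈S , v∉S , u~v , T-members , gp) =
    f u , f v , ∈-map⁺ f u∈S , fv∉ , f-adjacent u~v , (λ x → mk⇔ (to x) (from x)) , map-generalPosition gp
    where
    fv∉ : f v ∉ map f S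
    fv∉ fv∈ with ∈-map⁻ f fv∈
    ... | _ , w∈S , fv≡fw = v∉S (subst (_∈ S) (sym (f-injective fv≡fw)) w∈S)
    to : ∀ x → x ∈ map f T → (x ∈ map f S × x ≢ f u) ⊎ x ≡ f v
    to x x∈ with ∈-map⁻ f x∈
    ... | w , w∈T , refl with Equivalence.to (T-members w) w∈T
    ...   | inj₁ (w∈S , w≢u) = inj₁ (∈-map⁺ f w∈S , w≢u ∘ f-injective)
    ...   | inj₂ refl        = inj₂ refl
    from : ∀ x → (x ∈ map f S × x ≢ f u) ⊎ x ≡ f v → x ∈ map f T
    from x (inj₁ (x∈ , x≢fu)) with ∈-map⁻ f x∈
    ... | w , w∈S , refl = ∈-map⁺ f (Equivalence.from (T-members w) (inj₁ (w∈S , x≢fu ∘ cong f)))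
    from x (inj₂ refl) = ∈-map⁺ f (Equivalence.from (T-members v) (inj₂ refl))

  map-linked : ∀ {cs} → Linked (LegalMove G) cs → Linked (LegalMove H) (map (map f) cs)
  map-linked = Linked-map⁺ ∘ Linked.map map-legalMove

module _ {w s : ℕ} (c : ℕ) .(c+w≤s : c + w ≤ s) where

  window : V (C4□P w) → V (C4□P s)
  window (a , j) = a , Fin.fromℕ< (<-≤-trans (+-monoʳ-< c (toℕ<n j)) c+w≤s)

  col-window : ∀ x → col (window x) ≡ c + col x
  col-window (a , j) = toℕ-fromℕ< _

  window-injective : Injective _≡_ _≡_ window
  window-injective {x} {y} eq =
    ×-≡,≡→≡ (cong row eq , toℕ-injective (+-cancelˡ-≡ c _ _
      (trans (sym (col-window x)) (trans (cong col eq) (col-window y)))))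

  window-adjacent : ∀ {x y} → Adj (C4□P w) x y → Adj (C4□P s) (window x) (window y)
  window-adjacent         (inj₁ (refl , a~b)) = inj₁ (refl , a~b)
  window-adjacent {x} {y} (inj₂ (refl , j~k)) = inj₂ (refl , Sum.map (shifted {x} {y}) (shifted {y} {x}) j~k)
    where
    shifted : ∀ {x y} → col y ≡ suc (col x) → col (window y) ≡ suc (col (window x))
    shifted {x} {y} e =
      trans (col-window y) (trans (cong (c +_) e) (trans (+-suc c (col x)) (cong suc (sym (col-window x)))))

  window-distance : ∀ x y → distance (window x) (window y) ≡ distance x y
  window-distance x@(a , _) y@(b , _) =
    cong (dC4 a b +_) (trans (cong₂ ∣_-_∣ (col-window x) (col-window y)) (∣m+n-m+o∣≡∣n-o∣ c (col x) (col y)))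

  window-reflects : ∀ {x y z} → OnGeodesic (C4□P s) (window x) (window y) (window z) →
                    OnGeodesic (C4□P w) x y z
  window-reflects {x} {y} {z} geodesic = Equivalence.from onGeodesic⇔between (begin
    distance x y + distance y z
      ≡⟨ cong₂ _+_ (window-distance x y) (window-distance y z) ⟨
    distance (window x) (window y) + distance (window y) (window z)
      ≡⟨ Equivalence.to onGeodesic⇔between geodesic ⟩
    distance (window x) (window z)
      ≡⟨ window-distance x z ⟩
    distance x z
      ∎)
    where open ≡-Reasoning

  open Embedding window-injective window-adjacent window-reflects public

window-step : ∀ {w s} c .(p : c + w ≤ s) .(p′ : suc c + w ≤ s) {a} {j k : Fin w} → toℕ k ≡ suc (toℕ j) →
              window c p (a , k) ≡ window (suc c) p′ (a , j)
window-step c p p′ {a} {j} k≡1+j = cong (a ,_) (toℕ-injective (begin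
  toℕ (Fin.fromℕ< _) ≡⟨ toℕ-fromℕ< _ ⟩
  c + _              ≡⟨ cong (c +_) k≡1+j ⟩
  c + suc (toℕ j)    ≡⟨ +-suc c (toℕ j) ⟩
  suc c + toℕ j      ≡⟨ toℕ-fromℕ< _ ⟨
  toℕ (Fin.fromℕ< _) ∎))
  where open ≡-Reasoning

module Tour (t : ℕ) where

  bound : ∀ {c} → c ≤ t → c + 3 ≤ 3 + t
  bound {c} c≤t = subst (_≤ 3 + t) (+-comm 3 c) (+-monoʳ-≤ 3 c≤t)

  below : ∀ {c k} → c + k ≡ t → c ≤ t
  below {c} {k} e = subst (c ≤_) e (m≤m+n c k)

  tour : ∀ c k → c + k ≡ t → List (List (V (C4□P (3 + t))))
  tour c zero    e = map (map (window c (bound (below e)))) sweep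
  tour c (suc k) e = map (map (window c (bound (below e)))) sweep ++ tour (suc c) k (trans (sym (+-suc c k)) e)

  tour-linked : ∀ c k (e : c + k ≡ t) →
                Linked (LegalMove (C4□P (3 + t))) (map (window c (bound (below e))) sweep-start ∷ tour c k e)
  tour-linked c zero    e = map-linked c (bound (below e)) sweep-legal
  tour-linked c (suc k) e = ++⁺ (map-linked c (bound (below e)) sweep-legal) joint (Linked.tail rest)
    where
    e′ = trans (sym (+-suc c k)) e
    rest = tour-linked (suc c) k e′
    shift : map (window c (bound (below e))) sweep-end
          ≡ map (window (suc c) (bound (below {suc c} {k} e′))) sweep-start
    shift = cong₂ _∷_ (moved refl) (cong₂ _∷_ (moved refl) (cong₂ _∷_ (moved refl) refl))
      where moved = window-step c (bound (below e)) (bound (below {suc c} {k} e′))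
    joint : Connected (LegalMove (C4□P (3 + t))) (just (map (window c (bound (below e))) sweep-end))
                      (List.head (tour (suc c) k e′))
    joint = subst (λ C → Connected (LegalMove (C4□P (3 + t))) (just C) (List.head (tour (suc c) k e′)))
                  (sym shift) (Linked.head′ rest)

  tour-begins : ∀ {P : List (V (C4□P (3 + t))) → Set} c k (e : c + k ≡ t) →
                Any P (map (map (window c (bound (below e)))) sweep) → Any P (tour c k e)
  tour-begins c zero    e = λ found → found
  tour-begins c (suc k) e = ++⁺ˡ

  tour-covers : ∀ c k (e : c + k ≡ t) {c′} (c′≤t : c′ ≤ t) → c ≤ c′ → c′ ≤ c + k →
                ∀ y → Any (window c′ (bound c′≤t) y ∈_) (tour c k e)
  tour-covers c k e c′≤t c≤c′ c′≤c+k y with m≤n⇒m<n∨m≡n c≤c′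
  ... | inj₂ refl = tour-begins c k e (Any-map⁺ (Any.map (∈-map⁺ (window c (bound c′≤t))) (sweep-covers y)))
  tour-covers c zero e c′≤t c≤c′ c′≤c+k y | inj₁ c<c′ =
    contradiction (≤-trans c′≤c+k (≤-reflexive (+-identityʳ c))) (<⇒≱ c<c′)
  tour-covers c (suc k) e {c′} c′≤t c≤c′ c′≤c+k y | inj₁ c<c′ =
    ++⁺ʳ _ (tour-covers (suc c) k _ c′≤t c<c′ (subst (c′ ≤_) (+-suc c k) c′≤c+k) y)

  in-some-window : ∀ (x : V (C4□P (3 + t))) → ∃ λ c → Σ (c ≤ t) λ c≤t → ∃ λ y → x ≡ window c (bound c≤t) y
  in-some-window (a , i) with toℕ i ≤? t
  ... | yes i≤t = toℕ i , i≤t , (a , zero)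
                , cong (a ,_) (toℕ-injective (sym (trans (toℕ-fromℕ< _) (+-identityʳ (toℕ i)))))
  ... | no  i≰t = t , ≤-refl , (a , Fin.fromℕ< j<3) , cong (a ,_) (toℕ-injective (sym (begin
      toℕ (Fin.fromℕ< _)       ≡⟨ toℕ-fromℕ< _ ⟩
      t + toℕ (Fin.fromℕ< j<3) ≡⟨ cong (t +_) (toℕ-fromℕ< j<3) ⟩
      t + (toℕ i ∸ t)          ≡⟨ m+[n∸m]≡n t≤i ⟩
      toℕ i                    ∎)))
    where
    open ≡-Reasoning
    t≤i = <⇒≤ (≰⇒> i≰t)
    j<3 : toℕ i ∸ t < 3
    j<3 = subst (toℕ i ∸ t <_) (m+n∸n≡m 3 t) (∸-monoˡ-< (toℕ<n i) t≤i)

  mobile-triple : Σ (List (V (C4□P (3 + t)))) λ S → Unique S × Mobile (C4□P (3 + t)) S × length S ≡ 3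
  mobile-triple = S , Unique.map⁺ (window-injective 0 (bound z≤n)) sweep-start-unique
                , ( map-generalPosition 0 (bound z≤n) sweep-start-generalPosition
                  , tour 0 t refl , tour-linked 0 t refl , covered)
                , refl
    where
    S = map (window 0 (bound z≤n)) sweep-start
    covered : ∀ x → Any (x ∈_) (S ∷ tour 0 t refl)
    covered x with in-some-window x
    ... | c , c≤t , y , refl = Any.there (tour-covers 0 t refl c≤t z≤n c≤t y)

proposition3p6 : ∀ (s : ℕ) → 3 ≤ s → MobEq (C4 □ Path s) 3
proposition3p6 (suc (suc (suc t))) (s≤s (s≤s (s≤s z≤n))) = Tour.mobile-triple t , λ S → mobile-size≤3
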